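{- Let $q=p^e$ with $p$ prime, $t\ge1$, $n\ge 2$, $d\ge 1$, and let $\boldsymbol{\sigma}=(\sigma_0,\ldots,\sigma_{d-1})$ with each $\sigma_i\in\mathrm{Gal}(\mathbb{F}_{q^t}|\mathbb{F}_q)$, $\sigma_i:x\mapsto x^{q^{h_i}}$, $0\le h_i<t$, such that $\sum_{i=0}^{d-1}q^{h_i}<q^t$. Let $\nu_{d,\boldsymbol{\sigma}}:\langle v\rangle\in\mathrm{PG}(n-1,q^t)\mapsto\langle v^{\sigma_0}\otimes\cdots\otimes v^{\sigma_{d-1}}\rangle\in\mathrm{PG}\big((\mathbb{F}_{q^t}^n)^{\otimes d}\big)$ and $\mathcal{V}_{d,\boldsymbol{\sigma}}$ its image. If $P_0,\ldots,P_{d+1}$ are $d+2$ distinct points of $\mathrm{PG}(n-1,q^t)$ such that $\nu_{d,\boldsymbol{\sigma}}(P_0),\ldots,\nu_{d,\boldsymbol{\sigma}}(P_{d+1})$ are linearly dependent, then $P_0,\ldots,P_{d+1}$ are contained in a line of $\mathrm{PG}(n-1,q^t)$.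
   Context: For $v=(x_0,\ldots,x_{n-1})$ and a field automorphism $\sigma$, $v^\sigma=(x_0^\sigma,\ldots,x_{n-1}^\sigma)$. -}

module Defs where

open import Level using (_⊔_)
open import Algebra.Bundles using (CommutativeRing)
open import Data.Nat using (ℕ; zero; suc; _^_) renaming (_+_ to _+ℕ_)
open import Data.Fin using (Fin; zero; suc)
open import Data.Product using (Σ; ∃; _×_; _,_)
open import Relation.Nullary using (¬_)

sumℕ : ∀ {m} → (Fin m → ℕ) → ℕ
sumℕ {zero} f = 0
sumℕ {suc m} f = f zero +ℕ sumℕ (λ i → f (suc i))

module _ {c ℓ} (F : CommutativeRing c ℓ) where
  open CommutativeRing F hiding (zero)

  pow : Carrier → ℕ → Carrier
  pow x zero = 1#
  pow x (suc k) = x * pow x k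

  sumF : ∀ {m} → (Fin m → Carrier) → Carrier
  sumF {zero} f = 0#
  sumF {suc m} f = f zero + sumF (λ i → f (suc i))

  prodF : ∀ {m} → (Fin m → Carrier) → Carrier
  prodF {zero} f = 1#
  prodF {suc m} f = f zero * prodF (λ i → f (suc i))

  IsField : Set (c ⊔ ℓ)
  IsField = (¬ (1# ≈ 0#)) × (∀ x → ¬ (x ≈ 0#) → ∃ λ y → x * y ≈ 1#)

  HasCard : ℕ → Set (c ⊔ ℓ)
  HasCard N = Σ (Fin N → Carrier) λ enum →
    (∀ i j → enum i ≈ enum j → i ≡ j) × (∀ x → ∃ λ i → enum i ≈ x)
    where open import Relation.Binary.PropositionalEquality using (_≡_)

  -- vectors of F^n and of (F^n)^{⊗d} (coordinates indexed by Fin d → Fin n)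
  IsZeroVec : ∀ {I : Set} → (I → Carrier) → Set ℓ
  IsZeroVec v = ∀ j → v j ≈ 0#

  SamePoint : ∀ {n} → (Fin n → Carrier) → (Fin n → Carrier) → Set (c ⊔ ℓ)
  SamePoint v w = ∃ λ a → ∀ j → v j ≈ a * w j

  frob : ℕ → ℕ → Carrier → Carrier
  frob q h x = pow x (q ^ h)

  -- v^{σ_0} ⊗ ... ⊗ v^{σ_{d-1}}, σ_i : x ↦ x^(q^(h i))
  twistedTensor : ∀ {n d} → ℕ → (Fin d → ℕ) → (Fin n → Carrier) → (Fin d → Fin n) → Carrier
  twistedTensor q h v J = prodF (λ i → frob q (h i) (v (J i)))

  LinDep : ∀ {m} {I : Set} → (Fin m → I → Carrier) → Set (c ⊔ ℓ)
  LinDep {m} w = Σ (Fin m → Carrier) λ λs →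
    (∃ λ k → ¬ (λs k ≈ 0#)) × (∀ J → sumF (λ k → λs k * w k J) ≈ 0#)

  OnALine : ∀ {m n} → (Fin m → Fin n → Carrier) → Set (c ⊔ ℓ)
  OnALine {m} {n} P = Σ (Fin n → Carrier) λ u → Σ (Fin n → Carrier) λ w →
    ∀ k → ∃ λ a → ∃ λ b → ∀ j → P k j ≈ a * u j + b * w j

{-# OPTIONS --safe #-}
module Submission where

-- In characteristic p every σᵢ is additive, so for linear forms b₀, …, b_{d-1} the product
-- ∏ᵢ σᵢ(⟨bᵢ, v⟩) is a fixed linear combination of the coordinates of ν(v); a linear relation among
-- the ν(Pₖ) with λ_{k₀} ≠ 0 is therefore inherited by these products, and so no d hyperplanes can
-- cover all points but P_{k₀} while missing P_{k₀}. Now take x = P_{k'} for some k' ≠ k₀. If P_{k₀}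
-- were off the line through x and another point y, one hyperplane through x and y missing P_{k₀},
-- together with one through each of the d - 1 remaining points missing P_{k₀}, would be such a
-- cover. So P_{k₀} lies on every line x y, and as P_{k₀} ≠ x, every y lies on the line x P_{k₀}.

open import Defs
open import Algebra.Bundles using (CommutativeRing; Semiring)
open import Data.Nat using (ℕ)
open import Data.Nat.Primality using (Prime)
open import Data.Fin using (Fin)
open import Relation.Binary.PropositionalEquality using (_≢_)
open import Relation.Nullary using (¬_)
open import Level using (_⊔_)
open import Function using (_∘_)
open import Data.Product using (Σ; ∃; ∃₂; _,_; proj₁; proj₂)
open import Data.Sum using (_⊎_; inj₁; inj₂)
open import Data.Empty using (⊥-elim)
open import Relation.Nullary using (yes; no)
open import Relation.Binary.Definitions using (Decidable)
open import Relation.Binary.PropositionalEquality as ≡ using (_≡_)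
import Data.Nat as ℕ
import Data.Nat.Properties as ℕ
import Data.Fin as Fin
import Data.Fin.Properties as Fin


-- The ring solver needs coefficients whose normal forms compute (so that x - x cancels); the
-- canonical map ℤ → R provides them for every commutative ring.
module IntegerRingSolver {c ℓ} (R : CommutativeRing c ℓ) where
  open CommutativeRing R
  open import Data.Integer as ℤ using (ℤ; +_; -[1+_]; _⊖_)
  import Data.Integer.Properties as ℤ
  open import Data.Sign as Sign using (Sign)
  import Data.Maybe as Maybe
  open import Relation.Nullary.Decidable using (dec⇒maybe)
  open import Algebra.Properties.Ring ring using (-‿distribˡ-*; -‿distribʳ-*; -‿involutive; -0#≈0#; -‿+-comm)
  open import Algebra.Properties.CommutativeSemigroup +-commutativeSemigroup using (interchange)
  open import Algebra.Properties.Semiring.Mult semiring using (_×_; ×-homo-+; ×1-homo-*)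
  open import Algebra.Solver.Ring.AlmostCommutativeRing using (fromCommutativeRing; _-Raw-AlmostCommutative⟶_)
  open import Relation.Binary.Reasoning.Setoid setoid

  ⟦_⟧ℤ : ℤ → Carrier
  ⟦ + n ⟧ℤ      = n × 1#
  ⟦ -[1+ n ] ⟧ℤ = - (ℕ.suc n × 1#)

  private
    signed : Sign → Carrier → Carrier
    signed Sign.+ x = x
    signed Sign.- x = - x

    signed-cong : ∀ s {x y} → x ≈ y → signed s x ≈ signed s y
    signed-cong Sign.+ x≈y = x≈y
    signed-cong Sign.- x≈y = -‿cong x≈y

    signed-* : ∀ s t x y → signed s x * signed t y ≈ signed (s Sign.* t) (x * y)
    signed-* Sign.+ Sign.+ x y = refl
    signed-* Sign.+ Sign.- x y = sym (-‿distribʳ-* x y)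
    signed-* Sign.- Sign.+ x y = sym (-‿distribˡ-* x y)
    signed-* Sign.- Sign.- x y = begin
      - x * - y   ≈⟨ -‿distribˡ-* x (- y) ⟨
      - (x * - y) ≈⟨ -‿cong (-‿distribʳ-* x y) ⟨
      - - (x * y) ≈⟨ -‿involutive (x * y) ⟩
      x * y       ∎

    ⟦◃⟧ : ∀ s n → ⟦ s ℤ.◃ n ⟧ℤ ≈ signed s (n × 1#)
    ⟦◃⟧ Sign.+ ℕ.zero    = refl
    ⟦◃⟧ Sign.- ℕ.zero    = sym -0#≈0#
    ⟦◃⟧ Sign.+ (ℕ.suc n) = refl
    ⟦◃⟧ Sign.- (ℕ.suc n) = refl

    ⟦⟧ℤ-signAbs : ∀ i → ⟦ i ⟧ℤ ≈ signed (ℤ.sign i) (ℤ.∣ i ∣ × 1#)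
    ⟦⟧ℤ-signAbs i = trans (reflexive (≡.cong ⟦_⟧ℤ (≡.sym (ℤ.◃-inverse i)))) (⟦◃⟧ (ℤ.sign i) ℤ.∣ i ∣)

    ⟦⊖⟧ : ∀ m n → ⟦ m ⊖ n ⟧ℤ ≈ m × 1# - n × 1#
    ⟦⊖⟧ ℕ.zero    ℕ.zero    = sym (trans (+-congˡ -0#≈0#) (+-identityʳ 0#))
    ⟦⊖⟧ ℕ.zero    (ℕ.suc n) = sym (+-identityˡ _)
    ⟦⊖⟧ (ℕ.suc m) ℕ.zero    = sym (trans (+-congˡ -0#≈0#) (+-identityʳ _))
    ⟦⊖⟧ (ℕ.suc m) (ℕ.suc n) = begin
      ⟦ ℕ.suc m ⊖ ℕ.suc n ⟧ℤ ≡⟨ ≡.cong ⟦_⟧ℤ (ℤ.[1+m]⊖[1+n]≡m⊖n m n) ⟩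
      ⟦ m ⊖ n ⟧ℤ             ≈⟨ ⟦⊖⟧ m n ⟩
      a - b                  ≈⟨ +-identityˡ (a - b) ⟨
      0# + (a - b)           ≈⟨ +-congʳ (-‿inverseʳ 1#) ⟨
      (1# - 1#) + (a - b)    ≈⟨ interchange 1# (- 1#) a (- b) ⟩
      (1# + a) + (- 1# - b)  ≈⟨ +-congˡ (-‿+-comm 1# b) ⟩
      (1# + a) - (1# + b)    ∎
      where a = m × 1#; b = n × 1#

    ⟦⟧ℤ-+ : ∀ i j → ⟦ i ℤ.+ j ⟧ℤ ≈ ⟦ i ⟧ℤ + ⟦ j ⟧ℤ
    ⟦⟧ℤ-+ -[1+ m ] -[1+ n ] = begin
      - (ℕ.suc (ℕ.suc (m ℕ.+ n)) × 1#)    ≡⟨ ≡.cong (λ k → - (ℕ.suc k × 1#)) (ℕ.+-suc m n) ⟨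
      - ((ℕ.suc m ℕ.+ ℕ.suc n) × 1#)      ≈⟨ -‿cong (×-homo-+ 1# (ℕ.suc m) (ℕ.suc n)) ⟩
      - (ℕ.suc m × 1# + ℕ.suc n × 1#)     ≈⟨ -‿+-comm _ _ ⟨
      - (ℕ.suc m × 1#) - (ℕ.suc n × 1#)   ∎
    ⟦⟧ℤ-+ -[1+ m ] (+ n)    = trans (⟦⊖⟧ n (ℕ.suc m)) (+-comm _ _)
    ⟦⟧ℤ-+ (+ m)    -[1+ n ] = ⟦⊖⟧ m (ℕ.suc n)
    ⟦⟧ℤ-+ (+ m)    (+ n)    = ×-homo-+ 1# m n

    ⟦⟧ℤ-* : ∀ i j → ⟦ i ℤ.* j ⟧ℤ ≈ ⟦ i ⟧ℤ * ⟦ j ⟧ℤ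
    ⟦⟧ℤ-* i j = begin
      ⟦ i ℤ.* j ⟧ℤ                                          ≈⟨ ⟦◃⟧ (s Sign.* t) (∣i∣ ℕ.* ∣j∣) ⟩
      signed (s Sign.* t) ((∣i∣ ℕ.* ∣j∣) × 1#)               ≈⟨ signed-cong (s Sign.* t) (×1-homo-* ∣i∣ ∣j∣) ⟩
      signed (s Sign.* t) ((∣i∣ × 1#) * (∣j∣ × 1#))           ≈⟨ signed-* s t _ _ ⟨
      signed s (∣i∣ × 1#) * signed t (∣j∣ × 1#)              ≈⟨ *-cong (⟦⟧ℤ-signAbs i) (⟦⟧ℤ-signAbs j) ⟨
      ⟦ i ⟧ℤ * ⟦ j ⟧ℤ                                        ∎
      where s = ℤ.sign i; t = ℤ.sign j; ∣i∣ = ℤ.∣ i ∣; ∣j∣ = ℤ.∣ j ∣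

    ⟦⟧ℤ-neg : ∀ i → ⟦ ℤ.- i ⟧ℤ ≈ - ⟦ i ⟧ℤ
    ⟦⟧ℤ-neg -[1+ n ]      = sym (-‿involutive _)
    ⟦⟧ℤ-neg (+ ℕ.zero)    = sym -0#≈0#
    ⟦⟧ℤ-neg (+ ℕ.suc n)   = refl

  ⟦⟧ℤ-homomorphism : ℤ.+-*-rawRing -Raw-AlmostCommutative⟶ fromCommutativeRing R
  ⟦⟧ℤ-homomorphism = record
    { ⟦_⟧    = ⟦_⟧ℤ
    ; +-homo = ⟦⟧ℤ-+
    ; *-homo = ⟦⟧ℤ-*
    ; -‿homo = ⟦⟧ℤ-neg
    ; 0-homo = refl
    ; 1-homo = +-identityʳ 1#
    }

  open import Algebra.Solver.Ring ℤ.+-*-rawRing (fromCommutativeRing R) ⟦⟧ℤ-homomorphism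
    (λ i j → Maybe.map (reflexive ∘ ≡.cong ⟦_⟧ℤ) (dec⇒maybe (i ℤ.≟ j))) public
    using (solve; _:=_; _:+_; _:*_; _:-_; :-_; con)


module PrimeBinomial where
  open import Data.Nat using (_*_; _∸_; _≤_; _<_; _!; z≤n; s≤s)
  open import Data.Nat.Properties using (_!*_!≢0)
  open import Data.Nat.Divisibility using (_∣_; _∤_; ∣1⇒≡1; ∣⇒≤; m∣m*n)
  open import Data.Nat.DivMod using (m*[n/m]≡n)
  open import Data.Nat.Primality using (euclidsLemma)
  open import Data.Nat.Combinatorics using (_C_; nCk≡n!/k![n-k]!; k![n∸k]!∣n!)

  prime≥2 : ∀ {p} → Prime p → 2 ≤ p
  prime≥2 {ℕ.suc (ℕ.suc p)} _ = s≤s (s≤s z≤n)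

  prime∤! : ∀ {p} → Prime p → ∀ {m} → m < p → p ∤ m !
  prime∤! p-prime {ℕ.zero} _ p∣1 = ℕ.<-irrefl (≡.sym (∣1⇒≡1 p∣1)) (prime≥2 p-prime)
  prime∤! p-prime {ℕ.suc m} m<p p∣m! with euclidsLemma (ℕ.suc m) (m !) p-prime p∣m!
  ... | inj₁ p∣1+m = ℕ.<⇒≱ m<p (∣⇒≤ p∣1+m)
  ... | inj₂ p∣m!  = prime∤! p-prime (ℕ.<-trans (ℕ.n<1+n m) m<p) p∣m!

  prime∣choose : ∀ {p k} → Prime p → 0 < k → k < p → p ∣ p C k
  prime∣choose {p} {k} p-prime 0<k k<p
    with euclidsLemma (k ! * (p ∸ k) !) (p C k) p-prime (≡.subst (p ∣_) (≡.sym p!≡) (n∣n! p 0<p))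
    where
    0<p = ℕ.<-trans 0<k k<p
    instance _ = k !* (p ∸ k) !≢0
    n∣n! : ∀ n → 0 < n → n ∣ n !
    n∣n! (ℕ.suc n) _ = m∣m*n (n !)
    p!≡ : (k ! * (p ∸ k) !) * (p C k) ≡ p !
    p!≡ = ≡.trans (≡.cong (k ! * (p ∸ k) ! *_) (nCk≡n!/k![n-k]! (ℕ.<⇒≤ k<p)))
                  (m*[n/m]≡n (k![n∸k]!∣n! (ℕ.<⇒≤ k<p)))
  ... | inj₂ p∣C = p∣C
  ... | inj₁ p∣k![p-k]! with euclidsLemma (k !) ((p ∸ k) !) p-prime p∣k![p-k]!
  ...   | inj₁ p∣k!     = ⊥-elim (prime∤! p-prime k<p p∣k!)
  ...   | inj₂ p∣[p-k]! = ⊥-elim (prime∤! p-prime (ℕ.∸-monoʳ-< 0<k (ℕ.<⇒≤ k<p)) p∣[p-k]!)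


module CommutativeRingLemmas {c ℓ} (R : CommutativeRing c ℓ) where
  open CommutativeRing R hiding (zero)
  open import Data.Fin using (zero; suc)
  open import Data.Vec.Functional using (Vector; _∷_; removeAt)
  open import Algebra.Morphism.Structures using (module NearSemiringMorphisms)
  open NearSemiringMorphisms (Semiring.rawNearSemiring semiring) (Semiring.rawNearSemiring semiring) public
    using (IsNearSemiringHomomorphism)
  open import Algebra.Properties.Semiring.Sum semiring public
    using (sum; sum-cong-≋; sum-replicate-zero; sum-remove; ∑-comm; ∑-distrib-+; *-distribˡ-sum; *-distribʳ-sum)
  open import Relation.Binary.Reasoning.Setoid setoid
  open import Algebra.Properties.CommutativeSemigroup *-commutativeSemigroup using (x∙yz≈y∙xz)
  open IntegerRingSolver R

  sumF≡sum : ∀ {m} (f : Fin m → Carrier) → sumF R f ≡ sum f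
  sumF≡sum {ℕ.zero}  f = ≡.refl
  sumF≡sum {ℕ.suc m} f = ≡.cong (f zero +_) (sumF≡sum (f ∘ suc))

  sum-zero : ∀ {m} {f : Fin m → Carrier} → (∀ i → f i ≈ 0#) → sum f ≈ 0#
  sum-zero {m} f≈0 = trans (sum-cong-≋ f≈0) (sum-replicate-zero m)

  sum-single : ∀ {m} (f : Fin m → Carrier) k₀ → (∀ k → k ≢ k₀ → f k ≈ 0#) → sum f ≈ f k₀
  sum-single {ℕ.suc m} f k₀ f≈0 = begin
    sum f                        ≈⟨ sum-remove f ⟩
    f k₀ + sum (removeAt f k₀)   ≈⟨ +-congˡ (sum-zero (λ r → f≈0 _ (Fin.punchInᵢ≢i k₀ r))) ⟩
    f k₀ + 0#                    ≈⟨ +-identityʳ (f k₀) ⟩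
    f k₀                         ∎

  prodF-≈0 : ∀ {m} (f : Fin m → Carrier) i → f i ≈ 0# → prodF R f ≈ 0#
  prodF-≈0 f zero    fi≈0 = trans (*-congʳ fi≈0) (zeroˡ _)
  prodF-≈0 f (suc i) fi≈0 = trans (*-congˡ (prodF-≈0 (f ∘ suc) i fi≈0)) (zeroʳ _)

  homo-sum : ∀ {σ} → IsNearSemiringHomomorphism σ → ∀ {m} (f : Fin m → Carrier) → σ (sum f) ≈ sum (σ ∘ f)
  homo-sum σ-homo {ℕ.zero}  f = 0#-homo
    where open IsNearSemiringHomomorphism σ-homo
  homo-sum σ-homo {ℕ.suc m} f = trans (+-homo _ _) (+-congˡ (homo-sum σ-homo (f ∘ suc)))
    where open IsNearSemiringHomomorphism σ-homo

  additive-multiplicative⇒isNearSemiringHomomorphism : ∀ {φ : Carrier → Carrier} →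
    (∀ {x y} → x ≈ y → φ x ≈ φ y) → (∀ x y → φ (x + y) ≈ φ x + φ y) → (∀ x y → φ (x * y) ≈ φ x * φ y) →
    IsNearSemiringHomomorphism φ
  additive-multiplicative⇒isNearSemiringHomomorphism {φ} φ-cong φ-+ φ-* = record
    { +-isMonoidHomomorphism = record
      { isMagmaHomomorphism = record { isRelHomomorphism = record { cong = φ-cong } ; homo = φ-+ }
      ; ε-homo              = identityʳ-unique (φ 0#) (φ 0#) (trans (sym (φ-+ 0# 0#)) (φ-cong (+-identityʳ 0#)))
      }
    ; *-homo = φ-*
    }
    where open import Algebra.Properties.Group +-group using (identityʳ-unique)

  dot : ∀ {n} → Vector Carrier n → Vector Carrier n → Carrier
  dot b v = sum (λ j → b j * v j)

  twistedForm : ∀ {d n} → (Fin d → Carrier → Carrier) → (Fin d → Vector Carrier n) → Vector Carrier n → Carrier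
  twistedForm σ b v = prodF R (λ i → σ i (dot (b i) v))

  relation-annihilates-twistedForms :
    ∀ {d m n} (σ : Fin d → Carrier → Carrier) → (∀ i → IsNearSemiringHomomorphism (σ i)) →
    (λs : Fin m → Carrier) (P : Fin m → Vector Carrier n) →
    (∀ (J : Fin d → Fin n) → sum (λ k → λs k * prodF R (λ i → σ i (P k (J i)))) ≈ 0#) →
    ∀ b → sum (λ k → λs k * twistedForm σ b (P k)) ≈ 0#
  relation-annihilates-twistedForms {ℕ.zero} σ σ-homo λs P relation b = relation (λ ())
  relation-annihilates-twistedForms {ℕ.suc d} {m} {n} σ σ-homo λs P relation b = begin
    sum (λ k → λs k * (σ₀ (dot (b zero) (P k)) * rest k))
      ≈⟨ sum-cong-≋ {m} expand ⟩
    sum (λ k → sum (λ j → κ j * (λs′ j k * rest k)))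
      ≈⟨ ∑-comm (λ k j → κ j * (λs′ j k * rest k)) ⟩
    sum (λ j → sum (λ k → κ j * (λs′ j k * rest k)))
      ≈⟨ sum-cong-≋ (λ j → *-distribˡ-sum (κ j) (λ k → λs′ j k * rest k)) ⟨
    sum (λ j → κ j * sum (λ k → λs′ j k * rest k))
      ≈⟨ sum-zero (λ j → trans (*-congˡ (annihilated j)) (zeroʳ (κ j))) ⟩
    0#
      ∎
    where
    -- Expanding σ₀ ⟨b₀, Pₖ⟩ = Σⱼ σ₀(b₀ j) σ₀(Pₖ j) moves the first tensor factor into the
    -- coefficients λs′ j, which again satisfy a relation with one factor fewer.
    σ₀ = σ zero
    open IsNearSemiringHomomorphism (σ-homo zero)
    κ : Fin n → Carrier
    κ j = σ₀ (b zero j)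
    λs′ : Fin n → Fin m → Carrier
    λs′ j k = λs k * σ₀ (P k j)
    rest : Fin m → Carrier
    rest k = twistedForm (σ ∘ suc) (b ∘ suc) (P k)
    annihilated : ∀ j → sum (λ k → λs′ j k * rest k) ≈ 0#
    annihilated j = relation-annihilates-twistedForms (σ ∘ suc) (σ-homo ∘ suc) (λs′ j) P
      (λ J → trans (sum-cong-≋ (λ k → *-assoc (λs k) _ _)) (relation (j ∷ J))) (b ∘ suc)
    expand : ∀ k → λs k * (σ₀ (dot (b zero) (P k)) * rest k) ≈ sum (λ j → κ j * (λs′ j k * rest k))
    expand k = begin
      λs k * (σ₀ (dot (b zero) (P k)) * rest k)
        ≈⟨ *-congˡ (*-congʳ (homo-sum (σ-homo zero) (λ j → b zero j * P k j))) ⟩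
      λs k * (sum (λ j → σ₀ (b zero j * P k j)) * rest k)
        ≈⟨ *-congˡ (*-congʳ (sum-cong-≋ {n} (λ j → *-homo (b zero j) (P k j)))) ⟩
      λs k * (sum (λ j → κ j * σ₀ (P k j)) * rest k)
        ≈⟨ x∙yz≈y∙xz (λs k) _ (rest k) ⟩
      sum (λ j → κ j * σ₀ (P k j)) * (λs k * rest k)
        ≈⟨ *-distribʳ-sum (λs k * rest k) (λ j → κ j * σ₀ (P k j)) ⟩
      sum (λ j → κ j * σ₀ (P k j) * (λs k * rest k))
        ≈⟨ sum-cong-≋ {n} (λ j → solve 4 (λ a s l r → a :* s :* (l :* r) := a :* (l :* s :* r))
                                          refl (κ j) (σ₀ (P k j)) (λs k) (rest k)) ⟩
      sum (λ j → κ j * (λs′ j k * rest k))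
        ∎


module Frobenius {c ℓ} (R : CommutativeRing c ℓ) where
  open CommutativeRing R hiding (zero)
  open import Data.Fin using (zero; suc; toℕ; fromℕ; inject₁)
  open import Data.Nat using (_<_; z≤n; s≤s)
  open import Data.Nat.Divisibility using (divides)
  open import Data.Nat.Combinatorics using (_C_; nCn≡1)
  open import Data.Vec.Functional using (init; last)
  open import Algebra.Properties.Semiring.Mult semiring using (_×_; ×-congʳ; ×-assoc-*; ×1-homo-*)
  open import Algebra.Properties.Semiring.Exp semiring using (_^_; ^-congˡ; ^-assocʳ)
  open import Algebra.Properties.CommutativeSemiring.Exp commutativeSemiring using (^-distrib-*)
  open import Algebra.Properties.CommutativeSemiring.Binomial commutativeSemiring using (theorem; binomialTerm)
  open import Algebra.Properties.Semiring.Sum semiring using (sum-init-last)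
  open CommutativeRingLemmas R using (IsNearSemiringHomomorphism; sum; sum-zero; additive-multiplicative⇒isNearSemiringHomomorphism)
  open PrimeBinomial using (prime∣choose)
  open import Relation.Binary.Reasoning.Setoid setoid

  pow≈^ : ∀ x k → pow R x k ≈ x ^ k
  pow≈^ x ℕ.zero    = refl
  pow≈^ x (ℕ.suc k) = *-congˡ (pow≈^ x k)

  ×1≈0⇒×≈0 : ∀ k z → k × 1# ≈ 0# → k × z ≈ 0#
  ×1≈0⇒×≈0 k z k×1≈0 = begin
    k × z         ≈⟨ ×-congʳ k (*-identityˡ z) ⟨
    k × (1# * z)  ≈⟨ ×-assoc-* k 1# z ⟨
    (k × 1#) * z  ≈⟨ *-congʳ k×1≈0 ⟩
    0# * z        ≈⟨ zeroˡ z ⟩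
    0#            ∎

  x+y^n≈x^n+y^n : ∀ m → (∀ k → 0 < k → k < ℕ.suc m → (ℕ.suc m C k) × 1# ≈ 0#) →
                  ∀ x y → (x + y) ^ ℕ.suc m ≈ x ^ ℕ.suc m + y ^ ℕ.suc m
  x+y^n≈x^n+y^n m middle≈0 x y = begin
    (x + y) ^ n                                                ≈⟨ theorem n x y ⟩
    term zero + sum (term ∘ suc)                               ≈⟨ +-congˡ (sum-init-last (term ∘ suc)) ⟩
    term zero + (sum (init (term ∘ suc)) + last (term ∘ suc))  ≈⟨ +-cong first (+-cong (sum-zero middle) final) ⟩
    y ^ n + (0# + x ^ n)                                       ≈⟨ +-congˡ (+-identityˡ (x ^ n)) ⟩
    y ^ n + x ^ n                                              ≈⟨ +-comm (y ^ n) (x ^ n) ⟩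
    x ^ n + y ^ n                                              ∎
    where
    n = ℕ.suc m
    term = binomialTerm x y n
    -- n C 0 computes to 1.
    first : term zero ≈ y ^ n
    first = trans (+-identityʳ _) (*-identityˡ _)
    middle : ∀ i → term (suc (inject₁ i)) ≈ 0#
    middle i = ×1≈0⇒×≈0 (n C ℕ.suc (toℕ (inject₁ i))) _
      (middle≈0 _ (s≤s z≤n) (s≤s (≡.subst (_< m) (≡.sym (Fin.toℕ-inject₁ i)) (Fin.toℕ<n i))))
    final : term (suc (fromℕ m)) ≈ x ^ n
    final rewrite Fin.toℕ-fromℕ m | nCn≡1 n | ℕ.n∸n≡0 m = trans (+-identityʳ _) (*-identityʳ _)

  x+y^p≈x^p+y^p : ∀ {p} → Prime p → p × 1# ≈ 0# → ∀ x y → (x + y) ^ p ≈ x ^ p + y ^ p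
  x+y^p≈x^p+y^p {ℕ.suc m} p-prime p×1≈0 = x+y^n≈x^n+y^n m choose≈0
    where
    p = ℕ.suc m
    choose≈0 : ∀ k → 0 < k → k < p → (p C k) × 1# ≈ 0#
    choose≈0 k 0<k k<p with prime∣choose p-prime 0<k k<p
    ... | divides q p∣C = begin
      (p C k) × 1#          ≡⟨ ≡.cong (_× 1#) p∣C ⟩
      (q ℕ.* p) × 1#        ≈⟨ ×1-homo-* q p ⟩
      (q × 1#) * (p × 1#)   ≈⟨ *-congˡ p×1≈0 ⟩
      (q × 1#) * 0#         ≈⟨ zeroʳ _ ⟩
      0#                    ∎

  module _ {p} (p-prime : Prime p) (p×1≈0 : p × 1# ≈ 0#) where

    x+y^p^k≈x^p^k+y^p^k : ∀ k x y → (x + y) ^ (p ℕ.^ k) ≈ x ^ (p ℕ.^ k) + y ^ (p ℕ.^ k)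
    x+y^p^k≈x^p^k+y^p^k ℕ.zero    x y = trans (*-identityʳ _) (sym (+-cong (*-identityʳ x) (*-identityʳ y)))
    x+y^p^k≈x^p^k+y^p^k (ℕ.suc k) x y = begin
      (x + y) ^ (p ℕ.* p ℕ.^ k)              ≈⟨ ^-assocʳ (x + y) p (p ℕ.^ k) ⟨
      ((x + y) ^ p) ^ (p ℕ.^ k)              ≈⟨ ^-congˡ (p ℕ.^ k) (x+y^p≈x^p+y^p p-prime p×1≈0 x y) ⟩
      (x ^ p + y ^ p) ^ (p ℕ.^ k)            ≈⟨ x+y^p^k≈x^p^k+y^p^k k (x ^ p) (y ^ p) ⟩
      (x ^ p) ^ (p ℕ.^ k) + (y ^ p) ^ (p ℕ.^ k) ≈⟨ +-cong (^-assocʳ x p (p ℕ.^ k)) (^-assocʳ y p (p ℕ.^ k)) ⟩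
      x ^ (p ℕ.* p ℕ.^ k) + y ^ (p ℕ.* p ℕ.^ k) ∎

    frob-isNearSemiringHomomorphism : ∀ e h → IsNearSemiringHomomorphism (frob R (p ℕ.^ e) h)
    frob-isNearSemiringHomomorphism e h = additive-multiplicative⇒isNearSemiringHomomorphism
      (λ {x} {y} x≈y → begin
        pow R x N                  ≈⟨ pow≈^ x N ⟩
        x ^ N                      ≈⟨ ^-congˡ N x≈y ⟩
        y ^ N                      ≈⟨ pow≈^ y N ⟨
        pow R y N                  ∎)
      (λ x y → begin
        pow R (x + y) N            ≈⟨ pow≈^ (x + y) N ⟩
        (x + y) ^ N                ≡⟨ ≡.cong ((x + y) ^_) N≡p^eh ⟩
        (x + y) ^ p^eh             ≈⟨ x+y^p^k≈x^p^k+y^p^k (e ℕ.* h) x y ⟩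
        x ^ p^eh + y ^ p^eh        ≡⟨ ≡.cong₂ (λ m n → x ^ m + y ^ n) N≡p^eh N≡p^eh ⟨
        x ^ N + y ^ N              ≈⟨ +-cong (pow≈^ x N) (pow≈^ y N) ⟨
        pow R x N + pow R y N      ∎)
      (λ x y → begin
        pow R (x * y) N            ≈⟨ pow≈^ (x * y) N ⟩
        (x * y) ^ N                ≈⟨ ^-distrib-* x y N ⟩
        x ^ N * y ^ N              ≈⟨ *-cong (pow≈^ x N) (pow≈^ y N) ⟨
        pow R x N * pow R y N      ∎)
      where
      N = (p ℕ.^ e) ℕ.^ h
      p^eh = p ℕ.^ (e ℕ.* h)
      N≡p^eh : N ≡ p^eh
      N≡p^eh = ℕ.^-*-assoc p e h


module FiniteRing {c ℓ} (R : CommutativeRing c ℓ) {N} (card : HasCard R N) where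
  open CommutativeRing R hiding (zero)
  open import Algebra.Properties.Semiring.Mult semiring using (_×_)
  open import Algebra.Properties.Semiring.Sum semiring using (sum; sum-permute; sum-cong-≋; ∑-distrib-+; sum-replicate)
  open import Algebra.Properties.Group +-group using (identityʳ-unique)
  open import Data.Fin.Permutation using (Permutation′; permutation)
  open IntegerRingSolver R
  open import Relation.Binary.Reasoning.Setoid setoid

  enumerate : Fin N → Carrier
  enumerate = proj₁ card

  index : Carrier → Fin N
  index x = proj₁ (proj₂ (proj₂ card) x)

  enumerate-index : ∀ x → enumerate (index x) ≈ x
  enumerate-index x = proj₂ (proj₂ (proj₂ card) x)

  index-cong : ∀ {x y} → x ≈ y → index x ≡ index y
  index-cong {x} {y} x≈y = proj₁ (proj₂ card) _ _ (trans (enumerate-index x) (trans x≈y (sym (enumerate-index y))))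

  index-enumerate : ∀ i → index (enumerate i) ≡ i
  index-enumerate i = proj₁ (proj₂ card) _ _ (enumerate-index (enumerate i))

  _≟_ : Decidable _≈_
  x ≟ y with index x Fin.≟ index y
  ... | yes ix≡iy = yes (trans (sym (enumerate-index x)) (trans (reflexive (≡.cong enumerate ix≡iy)) (enumerate-index y)))
  ... | no ix≢iy  = no (ix≢iy ∘ index-cong)

  -- Translation by 1# permutes the elements, so it does not change their sum.
  N×1≈0 : N × 1# ≈ 0#
  N×1≈0 = identityʳ-unique (sum enumerate) (N × 1#) (begin
    sum enumerate + N × 1#                  ≈⟨ +-congˡ (sum-replicate N) ⟨
    sum enumerate + sum {N} (λ _ → 1#)      ≈⟨ ∑-distrib-+ enumerate (λ _ → 1#) ⟨
    sum (λ i → enumerate i + 1#)            ≈⟨ sum-cong-≋ {N} (λ i → enumerate-index (enumerate i + 1#)) ⟨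
    sum (enumerate ∘ translate)             ≈⟨ sum-permute enumerate translation ⟨
    sum enumerate                           ∎)
    where
    translate untranslate : Fin N → Fin N
    translate i = index (enumerate i + 1#)
    untranslate i = index (enumerate i - 1#)
    translate-untranslate : ∀ i → translate (untranslate i) ≡ i
    translate-untranslate i = ≡.trans (index-cong (trans (+-congʳ (enumerate-index _))
      (solve 2 (λ a b → a :- b :+ b := a) refl (enumerate i) 1#))) (index-enumerate i)
    untranslate-translate : ∀ i → untranslate (translate i) ≡ i
    untranslate-translate i = ≡.trans (index-cong (trans (+-congʳ (enumerate-index _))
      (solve 2 (λ a b → a :+ b :- b := a) refl (enumerate i) 1#))) (index-enumerate i)
    translation : Permutation′ N
    translation = permutation translate untranslate translate-untranslate untranslate-translate


module FieldLemmas {c ℓ} (F : CommutativeRing c ℓ) (isField : IsField F)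
                   (_≟_ : Decidable (CommutativeRing._≈_ F)) where
  open CommutativeRing F hiding (zero)
  open import Data.Product using (_×_)
  open import Data.Fin using (zero; suc; punchIn; punchOut)
  open import Data.Fin.Properties using (all?; ¬∀⟶∃¬; punchInᵢ≢i; punchIn-punchOut; punchIn-injective; 0≢1+n)
  open import Data.Vec.Functional using (Vector)
  open import Algebra.Properties.Group +-group using (x∙y⁻¹≈ε⇒x≈y)
  open CommutativeRingLemmas F
  open IntegerRingSolver F
  import Data.Integer as ℤ
  open import Relation.Binary.Reasoning.Setoid setoid

  1≉0 : 1# ≉ 0#
  1≉0 = proj₁ isField

  inverse : ∀ x → x ≉ 0# → ∃ λ y → x * y ≈ 1#
  inverse = proj₂ isField


  *-≉0 : ∀ {x y} → x ≉ 0# → y ≉ 0# → x * y ≉ 0#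
  *-≉0 {x} {y} x≉0 y≉0 xy≈0 = y≉0 (begin
    y                ≈⟨ *-identityˡ y ⟨
    1# * y           ≈⟨ *-congʳ (proj₂ (inverse x x≉0)) ⟨
    (x * x⁻¹) * y    ≈⟨ solve 3 (λ x x⁻¹ y → x :* x⁻¹ :* y := x⁻¹ :* (x :* y)) refl x x⁻¹ y ⟩
    x⁻¹ * (x * y)    ≈⟨ *-congˡ xy≈0 ⟩
    x⁻¹ * 0#         ≈⟨ zeroʳ x⁻¹ ⟩
    0#               ∎)
    where x⁻¹ = proj₁ (inverse x x≉0)

  x*y≈0⇒x≈0∨y≈0 : ∀ {x y} → x * y ≈ 0# → x ≈ 0# ⊎ y ≈ 0#
  x*y≈0⇒x≈0∨y≈0 {x} {y} xy≈0 with x ≟ 0# | y ≟ 0#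
  ... | yes x≈0 | _       = inj₁ x≈0
  ... | no _    | yes y≈0 = inj₂ y≈0
  ... | no x≉0  | no y≉0  = ⊥-elim (*-≉0 x≉0 y≉0 xy≈0)

  prodF-≉0 : ∀ {m} (f : Fin m → Carrier) → (∀ i → f i ≉ 0#) → prodF F f ≉ 0#
  prodF-≉0 {ℕ.zero}  f f≉0 = 1≉0
  prodF-≉0 {ℕ.suc m} f f≉0 = *-≉0 (f≉0 zero) (prodF-≉0 (f ∘ suc) (f≉0 ∘ suc))

  pow≈0⇒≈0 : ∀ {x} k → pow F x k ≈ 0# → x ≈ 0#
  pow≈0⇒≈0 ℕ.zero    1≈0 = ⊥-elim (1≉0 1≈0)
  pow≈0⇒≈0 (ℕ.suc k) xxᵏ≈0 with x*y≈0⇒x≈0∨y≈0 xxᵏ≈0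
  ... | inj₁ x≈0  = x≈0
  ... | inj₂ xᵏ≈0 = pow≈0⇒≈0 k xᵏ≈0

  module _ {n : ℕ} where

    InSpan : Vector Carrier n → Vector Carrier n → Vector Carrier n → Set (c ⊔ ℓ)
    InSpan v u w = ∃ λ a → ∃ λ b → ∀ j → v j ≈ a * u j + b * w j

    unit : Fin n → Vector Carrier n
    unit j k with j Fin.≟ k
    ... | yes _ = 1#
    ... | no _  = 0#

    dot-unit : ∀ j v → dot (unit j) v ≈ v j
    dot-unit j v = begin
      dot (unit j) v   ≈⟨ sum-single (λ k → unit j k * v k) j off-diagonal ⟩
      unit j j * v j   ≈⟨ *-congʳ diagonal ⟩
      1# * v j         ≈⟨ *-identityˡ (v j) ⟩
      v j              ∎
      where
      diagonal : unit j j ≈ 1#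
      diagonal with j Fin.≟ j
      ... | yes _  = refl
      ... | no j≢j = ⊥-elim (j≢j ≡.refl)
      off-diagonal : ∀ k → k ≢ j → unit j k * v k ≈ 0#
      off-diagonal k k≢j with j Fin.≟ k
      ... | yes j≡k = ⊥-elim (k≢j (≡.sym j≡k))
      ... | no _    = zeroˡ (v k)

    dot-+ : ∀ u w v → dot (λ k → u k + w k) v ≈ dot u v + dot w v
    dot-+ u w v = trans (sum-cong-≋ {n} (λ k → distribʳ (v k) (u k) (w k))) (∑-distrib-+ (λ k → u k * v k) (λ k → w k * v k))

    dot-* : ∀ a u v → dot (λ k → a * u k) v ≈ a * dot u v
    dot-* a u v = trans (sum-cong-≋ {n} (λ k → *-assoc a (u k) (v k))) (sym (*-distribˡ-sum a (λ k → u k * v k)))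

    dot-unit₂ : ∀ a b j l v → dot (λ k → a * unit j k + b * unit l k) v ≈ a * v j + b * v l
    dot-unit₂ a b j l v = begin
      dot (λ k → a * unit j k + b * unit l k) v              ≈⟨ dot-+ (λ k → a * unit j k) (λ k → b * unit l k) v ⟩
      dot (λ k → a * unit j k) v + dot (λ k → b * unit l k) v ≈⟨ +-cong (dot-* a (unit j) v) (dot-* b (unit l) v) ⟩
      a * dot (unit j) v + b * dot (unit l) v                 ≈⟨ +-cong (*-congˡ (dot-unit j v)) (*-congˡ (dot-unit l v)) ⟩
      a * v j + b * v l                                       ∎

    minor : Vector Carrier n → Vector Carrier n → Fin n → Fin n → Carrier
    minor x y j l = x j * y l - x l * y j

    minorForm : Vector Carrier n → Fin n → Fin n → Vector Carrier n
    minorForm w j l k = w j * unit l k + (- w l) * unit j k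

    dot-minorForm : ∀ w v j l → dot (minorForm w j l) v ≈ minor w v j l
    dot-minorForm w v j l = trans (dot-unit₂ (w j) (- w l) l j v)
      (solve 4 (λ wj vl wl vj → wj :* vl :+ (:- wl) :* vj := wj :* vl :- wl :* vj) refl (w j) (v l) (w l) (v j))

    minor-self : ∀ w j l → minor w w j l ≈ 0#
    minor-self w j l = solve 2 (λ wj wl → wj :* wl :- wl :* wj := con (ℤ.+ 0)) refl (w j) (w l)

    minors≈0⇒samePoint : ∀ {x z} j₀ → x j₀ ≉ 0# → (∀ j l → minor x z j l ≈ 0#) → SamePoint F z x
    minors≈0⇒samePoint {x} {z} j₀ xj₀≉0 minors≈0 = z j₀ * x⁻¹ , λ m → begin
      z m                      ≈⟨ *-identityʳ (z m) ⟨
      z m * 1#                 ≈⟨ *-congˡ (proj₂ (inverse (x j₀) xj₀≉0)) ⟨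
      z m * (x j₀ * x⁻¹)       ≈⟨ solve 3 (λ a b c → a :* (b :* c) := c :* (b :* a)) refl (z m) (x j₀) x⁻¹ ⟩
      x⁻¹ * (x j₀ * z m)       ≈⟨ *-congˡ (x∙y⁻¹≈ε⇒x≈y _ _ (minors≈0 j₀ m)) ⟩
      x⁻¹ * (x m * z j₀)       ≈⟨ solve 3 (λ a b c → a :* (b :* c) := c :* a :* b) refl x⁻¹ (x m) (z j₀) ⟩
      z j₀ * x⁻¹ * x m         ∎
      where x⁻¹ = proj₁ (inverse (x j₀) xj₀≉0)

    nonzeroMinor : ∀ {x z} → ¬ IsZeroVec F x → ¬ SamePoint F z x → ∃₂ λ j l → minor x z j l ≉ 0#
    nonzeroMinor {x} {z} x≢0 z≁x with all? (λ j → all? (λ l → minor x z j l ≟ 0#))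
    ... | yes minors≈0 = ⊥-elim (z≁x (minors≈0⇒samePoint j₀ xj₀≉0 minors≈0))
      where
      j₀ = proj₁ (¬∀⟶∃¬ n _ (λ j → x j ≟ 0#) x≢0)
      xj₀≉0 = proj₂ (¬∀⟶∃¬ n _ (λ j → x j ≟ 0#) x≢0)
    ... | no ¬minors≈0 with ¬∀⟶∃¬ n _ (λ j → all? (λ l → minor x z j l ≟ 0#)) ¬minors≈0
    ...   | j , ¬minorsⱼ≈0 = j , ¬∀⟶∃¬ n _ (λ l → minor x z j l ≟ 0#) ¬minorsⱼ≈0

    separatingForm₁ : ∀ {w z} → ¬ IsZeroVec F w → ¬ SamePoint F z w → ∃ λ b → dot b w ≈ 0# × dot b z ≉ 0#
    separatingForm₁ {w} {z} w≢0 z≁w with nonzeroMinor w≢0 z≁w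
    ... | j , l , minor≉0 = minorForm w j l
                          , trans (dot-minorForm w w j l) (minor-self w j l)
                          , minor≉0 ∘ trans (sym (dot-minorForm w z j l))

    det3 : Vector Carrier n → Vector Carrier n → Vector Carrier n → Fin n → Fin n → Fin n → Carrier
    det3 x y z j l m = (minor x y l m * z j + minor x y m j * z l) + minor x y j l * z m

    det3Form : Vector Carrier n → Vector Carrier n → Fin n → Fin n → Fin n → Vector Carrier n
    det3Form x y j l m k = (minor x y l m * unit j k + minor x y m j * unit l k) + minor x y j l * unit m k

    dot-det3Form : ∀ x y z j l m → dot (det3Form x y j l m) z ≈ det3 x y z j l m
    dot-det3Form x y z j l m = begin
      dot (det3Form x y j l m) z
        ≈⟨ dot-+ (λ k → minor x y l m * unit j k + minor x y m j * unit l k) (λ k → minor x y j l * unit m k) z ⟩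
      dot (λ k → minor x y l m * unit j k + minor x y m j * unit l k) z + dot (λ k → minor x y j l * unit m k) z
        ≈⟨ +-cong (dot-unit₂ _ _ j l z) (trans (dot-* _ (unit m) z) (*-congˡ (dot-unit m z))) ⟩
      det3 x y z j l m ∎

    det3-first : ∀ x y j l m → det3 x y x j l m ≈ 0#
    det3-first x y j l m = solve 6 (λ xj xl xm yj yl ym →
      ((xl :* ym :- xm :* yl) :* xj :+ (xm :* yj :- xj :* ym) :* xl) :+ (xj :* yl :- xl :* yj) :* xm := con (ℤ.+ 0))
      refl (x j) (x l) (x m) (y j) (y l) (y m)

    det3-second : ∀ x y j l m → det3 x y y j l m ≈ 0#
    det3-second x y j l m = solve 6 (λ xj xl xm yj yl ym →
      ((xl :* ym :- xm :* yl) :* yj :+ (xm :* yj :- xj :* ym) :* yl) :+ (xj :* yl :- xl :* yj) :* ym := con (ℤ.+ 0))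
      refl (x j) (x l) (x m) (y j) (y l) (y m)

    cramer : ∀ x y z j l m → minor z y j l * x m + minor x z j l * y m + det3 x y z j l m ≈ minor x y j l * z m
    cramer x y z j l m = solve 9 (λ xj xl xm yj yl ym zj zl zm →
      (zj :* yl :- zl :* yj) :* xm :+ (xj :* zl :- xl :* zj) :* ym
        :+ (((xl :* ym :- xm :* yl) :* zj :+ (xm :* yj :- xj :* ym) :* zl) :+ (xj :* yl :- xl :* yj) :* zm)
      := (xj :* yl :- xl :* yj) :* zm)
      refl (x j) (x l) (x m) (y j) (y l) (y m) (z j) (z l) (z m)

    det3≈0⇒inSpan : ∀ {x y z j l} → minor x y j l ≉ 0# → (∀ m → det3 x y z j l m ≈ 0#) → InSpan z x y
    det3≈0⇒inSpan {x} {y} {z} {j} {l} D≉0 det3≈0 = D⁻¹ * minor z y j l , D⁻¹ * minor x z j l , λ m → begin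
      z m                                                      ≈⟨ *-identityˡ (z m) ⟨
      1# * z m                                                 ≈⟨ *-congʳ (trans (*-comm _ _) (proj₂ (inverse D D≉0))) ⟨
      D⁻¹ * D * z m                                            ≈⟨ *-assoc D⁻¹ D (z m) ⟩
      D⁻¹ * (D * z m)                                          ≈⟨ *-congˡ (cramer x y z j l m) ⟨
      D⁻¹ * (minor z y j l * x m + minor x z j l * y m + det3 x y z j l m)
        ≈⟨ *-congˡ (trans (+-congˡ (det3≈0 m)) (+-identityʳ _)) ⟩
      D⁻¹ * (minor z y j l * x m + minor x z j l * y m)
        ≈⟨ solve 5 (λ d a xm b ym → d :* (a :* xm :+ b :* ym) := d :* a :* xm :+ d :* b :* ym)
                   refl D⁻¹ (minor z y j l) (x m) (minor x z j l) (y m) ⟩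
      D⁻¹ * minor z y j l * x m + D⁻¹ * minor x z j l * y m     ∎
      where
      D = minor x y j l
      D⁻¹ = proj₁ (inverse D D≉0)

    separatingForm₂ : ∀ {x y} z → ¬ IsZeroVec F x → ¬ SamePoint F y x →
      InSpan z x y ⊎ ∃ λ b → dot b x ≈ 0# × dot b y ≈ 0# × dot b z ≉ 0#
    separatingForm₂ {x} {y} z x≢0 y≁x with nonzeroMinor x≢0 y≁x
    ... | j , l , minor≉0 with all? (λ m → det3 x y z j l m ≟ 0#)
    ...   | yes det3≈0 = inj₁ (det3≈0⇒inSpan minor≉0 det3≈0)
    ...   | no ¬det3≈0 with ¬∀⟶∃¬ n _ (λ m → det3 x y z j l m ≟ 0#) ¬det3≈0
    ...     | m , det3≉0 = inj₂ (det3Form x y j l m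
                                , trans (dot-det3Form x y x j l m) (det3-first x y j l m)
                                , trans (dot-det3Form x y y j l m) (det3-second x y j l m)
                                , det3≉0 ∘ trans (sym (dot-det3Form x y z j l m)))

    inSpan-exchange : ∀ {x y z} → InSpan z x y → ¬ SamePoint F z x → InSpan y x z
    inSpan-exchange {x} {y} {z} (α , β , z≈αx+βy) z≁x with β ≟ 0#
    ... | yes β≈0 = ⊥-elim (z≁x (α , λ m → begin
      z m                ≈⟨ z≈αx+βy m ⟩
      α * x m + β * y m  ≈⟨ +-congˡ (trans (*-congʳ β≈0) (zeroˡ (y m))) ⟩
      α * x m + 0#       ≈⟨ +-identityʳ _ ⟩
      α * x m            ∎))
    ... | no β≉0 = - (β⁻¹ * α) , β⁻¹ , λ m → begin
      y m                                  ≈⟨ *-identityˡ (y m) ⟨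
      1# * y m                             ≈⟨ *-congʳ (proj₂ (inverse β β≉0)) ⟨
      β * β⁻¹ * y m
        ≈⟨ solve 5 (λ b b⁻¹ a xm ym → b :* b⁻¹ :* ym := :- (b⁻¹ :* a) :* xm :+ b⁻¹ :* (a :* xm :+ b :* ym))
                   refl β β⁻¹ α (x m) (y m) ⟩
      - (β⁻¹ * α) * x m + β⁻¹ * (α * x m + β * y m) ≈⟨ +-congˡ (*-congˡ (z≈αx+βy m)) ⟨
      - (β⁻¹ * α) * x m + β⁻¹ * z m        ∎
      where β⁻¹ = proj₁ (inverse β β≉0)

  IsolatingHyperplanes : ∀ {m n} → ℕ → (Fin m → Vector Carrier n) → Fin m → Set (c ⊔ ℓ)
  IsolatingHyperplanes {n = n} d P k₀ = Σ (Fin d → Vector Carrier n) λ b →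
    (∀ i → dot (b i) (P k₀) ≉ 0#) × (∀ k → k ≢ k₀ → ∃ λ i → dot (b i) (P k) ≈ 0#)

  linearRelation⇒¬isolating :
    ∀ {d m n} (σ : Fin d → Carrier → Carrier) → (∀ i → IsNearSemiringHomomorphism (σ i)) →
    (∀ i x → σ i x ≈ 0# → x ≈ 0#) →
    (λs : Fin m → Carrier) (P : Fin m → Vector Carrier n) →
    (∀ (J : Fin d → Fin n) → sum (λ k → λs k * prodF F (λ i → σ i (P k (J i)))) ≈ 0#) →
    ∀ {k₀} → λs k₀ ≉ 0# → ¬ IsolatingHyperplanes d P k₀
  linearRelation⇒¬isolating σ σ-homo σ-reflects-0 λs P relation {k₀} λk₀≉0 (b , avoid , cover) =
    *-≉0 λk₀≉0 (prodF-≉0 _ (λ i → avoid i ∘ σ-reflects-0 i _)) (begin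
      λs k₀ * twistedForm σ b (P k₀)            ≈⟨ sum-single (λ k → λs k * twistedForm σ b (P k)) k₀ others≈0 ⟨
      sum (λ k → λs k * twistedForm σ b (P k))  ≈⟨ relation-annihilates-twistedForms σ σ-homo λs P relation b ⟩
      0#                                        ∎)
    where
    others≈0 : ∀ k → k ≢ k₀ → λs k * twistedForm σ b (P k) ≈ 0#
    others≈0 k k≢k₀ with cover k k≢k₀
    ... | i , bᵢPₖ≈0 = trans (*-congˡ (prodF-≈0 _ i (trans (⟦⟧-cong bᵢPₖ≈0) 0#-homo))) (zeroʳ (λs k))
      where open IsNearSemiringHomomorphism (σ-homo i)

  isolatingHyperplanes : ∀ {d n} (P : Fin (2 ℕ.+ d) → Vector Carrier n) →
    (∀ k → ¬ IsZeroVec F (P k)) → (∀ k l → k ≢ l → ¬ SamePoint F (P k) (P l)) →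
    ∀ k₀ r b₀ → dot b₀ (P (punchIn k₀ zero)) ≈ 0# → dot b₀ (P (punchIn k₀ (suc r))) ≈ 0# →
    dot b₀ (P k₀) ≉ 0# →
    IsolatingHyperplanes d P k₀
  isolatingHyperplanes {ℕ.suc d} {n} P P≢0 distinct k₀ r b₀ b₀x≈0 b₀y≈0 b₀z≉0 = b , avoid , cover
    where
    other : Fin d → Fin (3 ℕ.+ d)
    other i = punchIn k₀ (suc (punchIn r i))
    separating : ∀ i → ∃ λ b → dot b (P (other i)) ≈ 0# × dot b (P k₀) ≉ 0#
    separating i = separatingForm₁ (P≢0 (other i)) (distinct k₀ (other i) (punchInᵢ≢i k₀ _ ∘ ≡.sym))
    b : Fin (ℕ.suc d) → Vector Carrier n
    b zero    = b₀
    b (suc i) = proj₁ (separating i)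
    avoid : ∀ i → dot (b i) (P k₀) ≉ 0#
    avoid zero    = b₀z≉0
    avoid (suc i) = proj₂ (proj₂ (separating i))
    coverOthers : ∀ s → ∃ λ i → dot (b i) (P (punchIn k₀ s)) ≈ 0#
    coverOthers zero = zero , b₀x≈0
    coverOthers (suc s) with r Fin.≟ s
    ... | yes ≡.refl = zero , b₀y≈0
    ... | no r≢s = suc (punchOut r≢s) ,
      ≡.subst (λ t → dot (b (suc (punchOut r≢s))) (P (punchIn k₀ (suc t))) ≈ 0#) (punchIn-punchOut r≢s)
              (proj₁ (proj₂ (separating (punchOut r≢s))))
    cover : ∀ k → k ≢ k₀ → ∃ λ i → dot (b i) (P k) ≈ 0#
    cover k k≢k₀ = ≡.subst (λ k → ∃ λ i → dot (b i) (P k) ≈ 0#) (punchIn-punchOut k₀≢k)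
                           (coverOthers (punchOut k₀≢k))
      where k₀≢k = k≢k₀ ∘ ≡.sym

  ¬isolating⇒onALine : ∀ {d n} (P : Fin (2 ℕ.+ d) → Vector Carrier n) →
    (∀ k → ¬ IsZeroVec F (P k)) → (∀ k l → k ≢ l → ¬ SamePoint F (P k) (P l)) →
    ∀ k₀ → ¬ IsolatingHyperplanes d P k₀ → OnALine F P
  ¬isolating⇒onALine P P≢0 distinct k₀ ¬isolating = x , z , onLine
    where
    x = P (punchIn k₀ zero)
    z = P k₀
    z∈span : ∀ r → InSpan z x (P (punchIn k₀ (suc r)))
    z∈span r with separatingForm₂ z (P≢0 _) (distinct _ _ (0≢1+n ∘ ≡.sym ∘ punchIn-injective k₀ (suc r) zero))
    ... | inj₁ z∈xy = z∈xy
    ... | inj₂ (b₀ , b₀x≈0 , b₀y≈0 , b₀z≉0) =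
      ⊥-elim (¬isolating (isolatingHyperplanes P P≢0 distinct k₀ r b₀ b₀x≈0 b₀y≈0 b₀z≉0))
    others∈span : ∀ s → InSpan (P (punchIn k₀ s)) x z
    others∈span zero    = 1# , 0# , λ j → sym (trans (+-cong (*-identityˡ (x j)) (zeroˡ (z j))) (+-identityʳ (x j)))
    others∈span (suc r) = inSpan-exchange (z∈span r) (distinct k₀ (punchIn k₀ zero) (punchInᵢ≢i k₀ zero ∘ ≡.sym))
    onLine : ∀ k → InSpan (P k) x z
    onLine k with k Fin.≟ k₀
    ... | yes ≡.refl = 0# , 1# , λ j → sym (trans (+-cong (zeroˡ (x j)) (*-identityˡ (z j))) (+-identityˡ (z j)))
    ... | no k≢k₀    = ≡.subst (λ k → InSpan (P k) x z) (punchIn-punchOut k₀≢k) (others∈span (punchOut k₀≢k))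
      where k₀≢k = k≢k₀ ∘ ≡.sym



module FieldCharacteristic {c ℓ} (F : CommutativeRing c ℓ) (isField : IsField F)
                           (_≟_ : Decidable (CommutativeRing._≈_ F)) where
  open CommutativeRing F
  open import Algebra.Properties.Semiring.Mult semiring using (_×_; ×1-homo-*)
  open FieldLemmas F isField _≟_ using (1≉0; x*y≈0⇒x≈0∨y≈0)

  p^k×1≈0⇒p×1≈0 : ∀ p k → (p ℕ.^ k) × 1# ≈ 0# → p × 1# ≈ 0#
  p^k×1≈0⇒p×1≈0 p ℕ.zero    1+0≈0     = ⊥-elim (1≉0 (trans (sym (+-identityʳ 1#)) 1+0≈0))
  p^k×1≈0⇒p×1≈0 p (ℕ.suc k) p^[1+k]×1≈0 with x*y≈0⇒x≈0∨y≈0 (trans (sym (×1-homo-* p (p ℕ.^ k))) p^[1+k]×1≈0)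
  ... | inj₁ p×1≈0   = p×1≈0
  ... | inj₂ p^k×1≈0 = p^k×1≈0⇒p×1≈0 p k p^k×1≈0


open import Data.Nat using (_^_; _≤_; _<_; _+_)

mainTheorem3 : ∀ {c ℓ} (F : CommutativeRing c ℓ) → IsField F →
    (p e t n d : ℕ) → Prime p → 1 ≤ e → 1 ≤ t → 2 ≤ n → 1 ≤ d →
    HasCard F ((p ^ e) ^ t) →
    (h : Fin d → ℕ) → (∀ i → h i < t) →
    sumℕ (λ i → (p ^ e) ^ h i) < (p ^ e) ^ t →
    (P : Fin (d + 2) → Fin n → CommutativeRing.Carrier F) →
    (∀ k → ¬ IsZeroVec F (P k)) →
    (∀ k l → k ≢ l → ¬ SamePoint F (P k) (P l)) →
    LinDep F (λ k → twistedTensor F (p ^ e) h (P k)) →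
    OnALine F P
mainTheorem3 F isField p e t n d p-prime _ _ _ _ card h _ _ P P≢0 distinct (λs , (k₀ , λk₀≉0) , relation) =
  onALine (ℕ.+-comm 2 d) P P≢0 distinct k₀
    (linearRelation⇒¬isolating σ σ-homo σ-reflects-0 λs P sumRelation λk₀≉0)
  where
  open CommutativeRing F using (Carrier; _≈_; 1#; 0#; _*_; semiring; reflexive; trans)
  open import Algebra.Properties.Semiring.Mult semiring using (_×_)
  open CommutativeRingLemmas F using (IsNearSemiringHomomorphism; sum; sumF≡sum)
  open FiniteRing F card using (_≟_; N×1≈0)
  open FieldLemmas F isField _≟_ using (IsolatingHyperplanes; linearRelation⇒¬isolating; ¬isolating⇒onALine; pow≈0⇒≈0)
  open FieldCharacteristic F isField _≟_ using (p^k×1≈0⇒p×1≈0)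

  p×1≈0 : p × 1# ≈ 0#
  p×1≈0 = p^k×1≈0⇒p×1≈0 p (e ℕ.* t) (≡.subst (λ N → N × 1# ≈ 0#) (ℕ.^-*-assoc p e t) N×1≈0)

  σ : Fin d → Carrier → Carrier
  σ i = frob F (p ^ e) (h i)

  σ-homo : ∀ i → IsNearSemiringHomomorphism (σ i)
  σ-homo i = Frobenius.frob-isNearSemiringHomomorphism F p-prime p×1≈0 e (h i)

  σ-reflects-0 : ∀ i x → σ i x ≈ 0# → x ≈ 0#
  σ-reflects-0 i x = pow≈0⇒≈0 ((p ^ e) ^ h i)

  sumRelation : ∀ J → sum (λ k → λs k * twistedTensor F (p ^ e) h (P k) J) ≈ 0#
  sumRelation J = trans (reflexive (≡.sym (sumF≡sum (λ k → λs k * twistedTensor F (p ^ e) h (P k) J)))) (relation J)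

  onALine : ∀ {M} → 2 + d ≡ M → (P : Fin M → Fin n → Carrier) →
    (∀ k → ¬ IsZeroVec F (P k)) → (∀ k l → k ≢ l → ¬ SamePoint F (P k) (P l)) →
    ∀ k₀ → ¬ IsolatingHyperplanes d P k₀ → OnALine F P
  onALine ≡.refl = ¬isolating⇒onALine
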